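{- Let $r\ge 2$. For $0\le n\le r-1$, the wide band Cayley continuant satisfies $V_n^{(r)}(x,y)=x^{(n)}$, where $x^{(0)}=1$ and $x^{(n)}=x(x+1)\cdots(x+n-1)$ for $n\ge 1$.
   Context: Fix an integer $r\ge 2$ and indeterminates $x,y$. For $n\ge 1$ let $A_n^{(r)}(x,y)=(a_{i,j})_{1\le i,j\le n}$ be the $n\times n$ matrix with $a_{i,i+1}=-i$ for $1\le i\le n-1$; $a_{i,j}=x$ whenever $0\le i-j\le r-2$; $a_{i,i-r+1}=y+i-r$ for $r\le i\le n$; and all other entries $0$. (So for $n\le r-1$ the matrix has $-1,-2,\dots,-(n-1)$ on the first superdiagonal, $x$ in every entry on or below the main diagonal, and $0$ elsewhere.) Define $V_0^{(r)}(x,y)=1$ and $V_n^{(r)}(x,y)=\det A_n^{(r)}(x,y)$ for $n\ge1$ (so $V_1^{(r)}(x,y)=x$). -}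

module Defs where

open import Level using (Level)
open import Algebra.Bundles using (CommutativeRing)
open import Data.Nat as ℕ using (ℕ; zero; suc; _≤?_; _≟_)
open import Data.Fin using (Fin; zero; suc; toℕ; punchIn)
open import Relation.Nullary using (yes; no)

module _ {c ℓ : Level} (R : CommutativeRing c ℓ) where
  open CommutativeRing R hiding (zero)

  fromℕ : ℕ → Carrier
  fromℕ zero = 0#
  fromℕ (suc k) = 1# + fromℕ k

  ∑ : (n : ℕ) → (Fin n → Carrier) → Carrier
  ∑ zero f = 0#
  ∑ (suc n) f = f zero + ∑ n (λ j → f (suc j))

  sgn : ℕ → Carrier
  sgn zero = 1#
  sgn (suc k) = - sgn k

  det : (n : ℕ) → (Fin n → Fin n → Carrier) → Carrier
  det zero M = 1#
  det (suc n) M =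
    ∑ (suc n) (λ j → sgn (toℕ j) * (M zero j * det n (λ a b → M (suc a) (punchIn j b))))

  -- entry a_{i,j} of A_n^{(r)}(x,y), with 1-based indices i j
  entry : ℕ → Carrier → Carrier → ℕ → ℕ → Carrier
  entry r x y i j with suc i ≟ j
  ... | yes _ = - fromℕ i
  ... | no _ with j ≤? i | i ≤? j ℕ.+ (r ℕ.∸ 2)
  ...   | yes _ | yes _ = x
  ...   | _ | _ with i ≟ j ℕ.+ (r ℕ.∸ 1) | r ≤? i
  ...     | yes _ | yes _ = y + fromℕ i + - fromℕ r
  ...     | _ | _ = 0#

  A : ℕ → (n : ℕ) → Carrier → Carrier → Fin n → Fin n → Carrier
  A r n x y i j = entry r x y (suc (toℕ i)) (suc (toℕ j))

  V : ℕ → ℕ → Carrier → Carrier → Carrier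
  V r n x y = det n (A r n x y)

  rising : Carrier → ℕ → Carrier
  rising x zero = 1#
  rising x (suc k) = rising x k * (x + fromℕ k)

{-# OPTIONS --safe #-}
-- For n ≤ r - 1 every entry of A_n^{(r)} with i - j ≤ n - 1 ≤ r - 2 is x, so the y-band never
-- enters: A_n^{(r)} is the lower Hessenberg matrix with x on and below the diagonal and
-- -1, …, -(n-1) above it. Expanding along the first row (x, -1, 0, …, 0), the two minors
-- coincide because the first two columns agree below the first row, so the determinant is
-- (x + 1) times that of the same kind of matrix with superdiagonal -2, …, -(n-1).
-- Iterating gives x (x + 1) ⋯ (x + n - 1).
module Submission where

open import Defs
open import Level using (Level)
open import Algebra.Bundles using (CommutativeRing)
open import Data.Nat as ℕ using (ℕ; _≤_; _∸_; zero; suc; _≤?_; _≟_; z≤n; s≤s; s≤s⁻¹)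
open import Data.Nat.Properties as ℕ using (≤-trans; m≤m+n; m≤n+m; suc-injective)
open import Data.Fin using (Fin; toℕ; punchIn) renaming (zero to fzero; suc to fsuc)
open import Data.Fin.Properties using (toℕ<n)
open import Data.Empty using (⊥-elim)
open import Relation.Nullary using (yes; no; ¬_)
open import Relation.Binary.PropositionalEquality as ≡ using (_≡_; _≢_)
import Algebra.Properties.Ring as RingProperties
import Algebra.Properties.CommutativeSemigroup as CommutativeSemigroupProperties
import Relation.Binary.Reasoning.Setoid as SetoidReasoning

module _ {c ℓ : Level} (R : CommutativeRing c ℓ) where
  open CommutativeRing R hiding (zero)
  open RingProperties ring using (-1*x≈-x; -‿distribˡ-*; -‿involutive)
  open CommutativeSemigroupProperties *-commutativeSemigroup using (x∙yz≈y∙xz)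
  open SetoidReasoning setoid

  ∑-cong : ∀ n {f g : Fin n → Carrier} → (∀ j → f j ≈ g j) → ∑ R n f ≈ ∑ R n g
  ∑-cong zero f≈g = refl
  ∑-cong (suc n) f≈g = +-cong (f≈g fzero) (∑-cong n (λ j → f≈g (fsuc j)))

  ∑-zero : ∀ n {f : Fin n → Carrier} → (∀ j → f j ≈ 0#) → ∑ R n f ≈ 0#
  ∑-zero zero f≈0 = refl
  ∑-zero (suc n) f≈0 = trans (+-cong (f≈0 fzero) (∑-zero n (λ j → f≈0 (fsuc j)))) (+-identityʳ 0#)

  det-cong : ∀ n {M N : Fin n → Fin n → Carrier} → (∀ i j → M i j ≈ N i j) → det R n M ≈ det R n N
  det-cong zero M≈N = refl
  det-cong (suc n) {M} {N} M≈N = ∑-cong (suc n) {expand M} {expand N} λ j →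
    *-congˡ (*-cong (M≈N fzero j) (det-cong n (λ a b → M≈N (fsuc a) (punchIn j b))))
    where
    expand : (Fin (suc n) → Fin (suc n) → Carrier) → Fin (suc n) → Carrier
    expand M j = sgn R (toℕ j) * (M fzero j * det R n (λ a b → M (fsuc a) (punchIn j b)))

  det-firstRow₂ : ∀ m (M : Fin (suc (suc m)) → Fin (suc (suc m)) → Carrier) →
                  (∀ j → M fzero (fsuc (fsuc j)) ≈ 0#) →
                  (∀ a → M (fsuc a) fzero ≈ M (fsuc a) (fsuc fzero)) →
                  det R (suc (suc m)) M
                    ≈ (M fzero fzero - M fzero (fsuc fzero)) * det R (suc m) (λ a b → M (fsuc a) (fsuc b))
  det-firstRow₂ m M row₀ cols₀₁ = begin
    1# * (a * D) + (- 1# * (b * D′) + ∑ R m rest) ≈⟨ +-cong (*-identityˡ _) (+-cong (-1*x≈-x _) (∑-zero m rest≈0)) ⟩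
    a * D + (- (b * D′) + 0#)                     ≈⟨ +-congˡ (+-identityʳ _) ⟩
    a * D + - (b * D′)                            ≈⟨ +-congˡ (-‿cong (*-congˡ D′≈D)) ⟩
    a * D + - (b * D)                             ≈⟨ +-congˡ (-‿distribˡ-* b D) ⟩
    a * D + - b * D                               ≈⟨ distribʳ D a (- b) ⟨
    (a - b) * D                                   ∎
    where
    a b D D′ : Carrier
    a = M fzero fzero
    b = M fzero (fsuc fzero)
    minor : Fin (suc (suc m)) → Fin (suc m) → Fin (suc m) → Carrier
    minor j i k = M (fsuc i) (punchIn j k)
    D = det R (suc m) (minor fzero)
    D′ = det R (suc m) (minor (fsuc fzero))
    rest : Fin m → Carrier
    rest j = sgn R (suc (suc (toℕ j))) * (M fzero (fsuc (fsuc j)) * det R (suc m) (minor (fsuc (fsuc j))))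
    rest≈0 : ∀ j → rest j ≈ 0#
    rest≈0 j = trans (*-congˡ (trans (*-congʳ (row₀ j)) (zeroˡ _))) (zeroʳ _)
    D′≈D : D′ ≈ D
    D′≈D = det-cong (suc m) {minor (fsuc fzero)} {minor fzero} λ { i fzero → cols₀₁ i ; i (fsuc k) → refl }

  module _ (x : Carrier) where

    risingFrom : ℕ → ℕ → Carrier
    risingFrom k zero = 1#
    risingFrom k (suc m) = (x + fromℕ R k) * risingFrom (suc k) m

    rising-*-risingFrom : ∀ k m → rising R x k * risingFrom k m ≈ rising R x (k ℕ.+ m)
    rising-*-risingFrom k zero = trans (*-identityʳ _) (reflexive (≡.cong (rising R x) (≡.sym (ℕ.+-identityʳ k))))
    rising-*-risingFrom k (suc m) = begin
      rising R x k * ((x + fromℕ R k) * risingFrom (suc k) m) ≈⟨ *-assoc _ _ _ ⟨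
      rising R x (suc k) * risingFrom (suc k) m               ≈⟨ rising-*-risingFrom (suc k) m ⟩
      rising R x (suc k ℕ.+ m)                                ≡⟨ ≡.cong (rising R x) (ℕ.+-suc k m) ⟨
      rising R x (k ℕ.+ suc m)                                ∎

    -- hessenberg k i j: x for j ≤ i, -(k + i + 1) for j = i + 1, 0 otherwise. The recursion on
    -- (i, j) makes the lower-right minor of hessenberg k definitionally hessenberg (suc k).
    hessenberg : ℕ → ℕ → ℕ → Carrier
    hessenberg k zero zero = x
    hessenberg k zero (suc zero) = - fromℕ R (suc k)
    hessenberg k zero (suc (suc j)) = 0#
    hessenberg k (suc i) zero = x
    hessenberg k (suc i) (suc j) = hessenberg (suc k) i j

    hessenberg-lower : ∀ k i j → j ≤ i → hessenberg k i j ≡ x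
    hessenberg-lower k zero zero _ = ≡.refl
    hessenberg-lower k (suc i) zero _ = ≡.refl
    hessenberg-lower k (suc i) (suc j) (s≤s j≤i) = hessenberg-lower (suc k) i j j≤i

    hessenberg-super : ∀ k i → hessenberg k i (suc i) ≡ - fromℕ R (k ℕ.+ suc i)
    hessenberg-super k zero = ≡.cong (λ t → - fromℕ R t) (ℕ.+-comm 1 k)
    hessenberg-super k (suc i) =
      ≡.trans (hessenberg-super (suc k) i) (≡.cong (λ t → - fromℕ R t) (≡.sym (ℕ.+-suc k (suc i))))

    hessenberg-upper : ∀ k i j → ¬ j ≤ i → j ≢ suc i → hessenberg k i j ≡ 0#
    hessenberg-upper k i zero j≰i _ = ⊥-elim (j≰i z≤n)
    hessenberg-upper k zero (suc zero) _ j≢1 = ⊥-elim (j≢1 ≡.refl)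
    hessenberg-upper k zero (suc (suc j)) _ _ = ≡.refl
    hessenberg-upper k (suc i) (suc j) j≰i j≢i+1 =
      hessenberg-upper (suc k) i j (λ j≤i → j≰i (s≤s j≤i)) (λ j≡i+1 → j≢i+1 (≡.cong suc j≡i+1))

    Hessenberg : ℕ → (n : ℕ) → Fin n → Fin n → Carrier
    Hessenberg k n i j = hessenberg k (toℕ i) (toℕ j)

    det-Hessenberg : ∀ k m → det R (suc m) (Hessenberg k (suc m)) ≈ x * risingFrom (suc k) m
    det-Hessenberg k zero = trans (+-identityʳ _) (*-identityˡ _)
    det-Hessenberg k (suc m) = begin
      det R (suc (suc m)) (Hessenberg k (suc (suc m)))
        ≈⟨ det-firstRow₂ m (Hessenberg k (suc (suc m))) (λ _ → refl)
             (λ a → reflexive (≡.sym (hessenberg-lower (suc k) (toℕ a) 0 z≤n))) ⟩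
      (x - - fromℕ R (suc k)) * det R (suc m) (Hessenberg (suc k) (suc m))
        ≈⟨ *-cong (+-congˡ (-‿involutive _)) (det-Hessenberg (suc k) m) ⟩
      (x + fromℕ R (suc k)) * (x * risingFrom (suc (suc k)) m)
        ≈⟨ x∙yz≈y∙xz _ x _ ⟩
      x * risingFrom (suc k) (suc m) ∎

    det-Hessenberg₀ : ∀ n → det R n (Hessenberg 0 n) ≈ rising R x n
    det-Hessenberg₀ zero = refl
    det-Hessenberg₀ (suc m) = begin
      det R (suc m) (Hessenberg 0 (suc m)) ≈⟨ det-Hessenberg 0 m ⟩
      x * risingFrom 1 m                   ≈⟨ *-congʳ (sym (trans (*-identityˡ _) (+-identityʳ x))) ⟩
      rising R x 1 * risingFrom 1 m        ≈⟨ rising-*-risingFrom 1 m ⟩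
      rising R x (suc m)                   ∎

    entry≡hessenberg : ∀ s y i j → i ≤ s → entry R (suc (suc s)) x y (suc i) (suc j) ≡ hessenberg 0 i j
    entry≡hessenberg s y i j i≤s with suc (suc i) ≟ suc j
    ... | yes i+2≡j+1 rewrite ≡.sym (suc-injective i+2≡j+1) = ≡.sym (hessenberg-super 0 i)
    ... | no i+2≢j+1 with suc j ≤? suc i | suc i ≤? suc j ℕ.+ s
    ...   | yes j≤i | yes _ = ≡.sym (hessenberg-lower 0 i j (s≤s⁻¹ j≤i))
    ...   | yes _ | no i≰j+s = ⊥-elim (i≰j+s (s≤s (≤-trans i≤s (m≤n+m s j))))
    ...   | no j≰i | _ with suc i ≟ suc j ℕ.+ suc s | suc (suc s) ≤? suc i
    ...     | yes i≡j+s+1 | _ = ⊥-elim (j≰i (≡.subst (suc j ≤_) (≡.sym i≡j+s+1) (m≤m+n (suc j) (suc s))))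
    ...     | no _ | _ = ≡.sym (hessenberg-upper 0 i j (λ j≤i → j≰i (s≤s j≤i)) (λ j≡i+1 → i+2≢j+1 (≡.cong suc (≡.sym j≡i+1))))

lemma2p1 : ∀ {c ℓ : Level} (R : CommutativeRing c ℓ) (r : ℕ) → 2 ≤ r →
    (n : ℕ) → n ≤ r ∸ 1 → (x y : CommutativeRing.Carrier R) →
    CommutativeRing._≈_ R (V R r n x y) (rising R x n)
lemma2p1 R (suc (suc s)) (s≤s (s≤s z≤n)) n n≤s+1 x y = begin
  V R (suc (suc s)) n x y      ≈⟨ det-cong R n (λ i j → reflexive (entry≡hessenberg R x s y (toℕ i) (toℕ j) (i≤s i))) ⟩
  det R n (Hessenberg R x 0 n) ≈⟨ det-Hessenberg₀ R x n ⟩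
  rising R x n                 ∎
  where
  open CommutativeRing R using (reflexive; setoid)
  open SetoidReasoning setoid
  i≤s : (i : Fin n) → toℕ i ≤ s
  i≤s i = s≤s⁻¹ (≤-trans (toℕ<n i) n≤s+1)
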